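{- Let $\langle T,\wedge,\vee,\rightarrow,\sim,0,1\rangle$ be an algebra of type $(2,2,2,1,0,0)$ such that $\langle T,\wedge,\vee,\sim,0,1\rangle$ is a Kleene algebra, $T$ satisfies conditions (hN1)–(hN6) below, and $T$ satisfies, for all $x,y,z\in T$, the equation $(x\rightarrow y)\vee(z\wedge\sim z)=(x\vee(z\wedge\sim z))\rightarrow(y\vee(z\wedge\sim z))$. Then for all $x,y\in T$ the following are equivalent: (1) $x\rightarrow y=1$ and $y\rightarrow x=1$; (2) there exists $z\in T$ such that $x\vee(z\wedge\sim z)=y\vee(z\wedge\sim z)$.
   Context: A Kleene algebra is a bounded distributive lattice $\langle T,\wedge,\vee,0,1\rangle$ with a unary operation $\sim$ such that $\sim\sim x=x$, $\sim(x\wedge y)=\sim x\vee\sim y$ and $(x\wedge\sim x)\wedge(y\vee\sim y)=x\wedge\sim x$. Conditions, for all $x,y\in T$: (hN1) $x\rightarrow x=1$; (hN2) $x\wedge(x\rightarrow y)\le x\wedge(\sim x\vee y)$; (hN3) $\sim(x\rightarrow y)\rightarrow(x\wedge\sim y)=1$; (hN4) $(x\wedge\sim y)\rightarrow\sim(x\rightarrow y)=1$; (hN5) $(x\wedge y\wedge(x\rightarrow y))\rightarrow(x\wedge(x\rightarrow y))=1$; (hN6) $(x\wedge(x\rightarrow y))\rightarrow(x\wedge y\wedge(x\rightarrow y))=1$. -}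

module Defs where

open import Level using (Level; suc)
open import Relation.Binary.PropositionalEquality using (_≡_)
open import Algebra.Core using (Op₁; Op₂)
open import Algebra.Lattice.Structures using (IsDistributiveLattice)

record HAlgebra (c : Level) : Set (suc c) where
  infixr 6 _∨_
  infixr 7 _∧_
  infixr 5 _⇒_
  field
    T   : Set c
    _∧_ : Op₂ T
    _∨_ : Op₂ T
    _⇒_ : Op₂ T
    ∼_  : Op₁ T
    𝟘   : T
    𝟙   : T

  _≤_ : T → T → Set c
  x ≤ y = x ∧ y ≡ x

record IsKleene {c : Level} (A : HAlgebra c) : Set c where
  open HAlgebra A
  field
    isDistributiveLattice : IsDistributiveLattice {A = T} _≡_ _∨_ _∧_
    ∧-identityʳ-𝟙 : ∀ x → x ∧ 𝟙 ≡ x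
    ∨-identityʳ-𝟘 : ∀ x → x ∨ 𝟘 ≡ x
    ∼-involutive : ∀ x → ∼ (∼ x) ≡ x
    ∼-deMorgan   : ∀ x y → ∼ (x ∧ y) ≡ (∼ x) ∨ (∼ y)
    kleene       : ∀ x y → (x ∧ ∼ x) ∧ (y ∨ ∼ y) ≡ x ∧ ∼ x

record SatisfiesHN {c : Level} (A : HAlgebra c) : Set c where
  open HAlgebra A
  field
    hN1 : ∀ x → (x ⇒ x) ≡ 𝟙
    hN2 : ∀ x y → (x ∧ (x ⇒ y)) ≤ (x ∧ (∼ x ∨ y))
    hN3 : ∀ x y → (∼ (x ⇒ y) ⇒ (x ∧ ∼ y)) ≡ 𝟙
    hN4 : ∀ x y → ((x ∧ ∼ y) ⇒ ∼ (x ⇒ y)) ≡ 𝟙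
    hN5 : ∀ x y → ((x ∧ y ∧ (x ⇒ y)) ⇒ (x ∧ (x ⇒ y))) ≡ 𝟙
    hN6 : ∀ x y → ((x ∧ (x ⇒ y)) ⇒ (x ∧ y ∧ (x ⇒ y))) ≡ 𝟙

{-# OPTIONS --safe #-}
module Submission where

-- (2) ⇒ (1): by the equation, (x ⇒ y) ∨ (z ∧ ∼z) = (x ∨ z ∧ ∼z) ⇒ (x ∨ z ∧ ∼z) = 1, and in a
-- Kleene algebra x ∨ e = 1 forces x = 1 whenever e ≤ ∼e, as is the case for e = z ∧ ∼z.
-- (1) ⇒ (2): by (hN2), x ⇒ y = 1 gives x ≤ ∼x ∨ y, and Kleene's law then puts x below
-- y ∨ (z ∧ ∼z) for z = x ∨ y; symmetrically y ≤ x ∨ (z ∧ ∼z).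

open import Defs
open import Level using (Level)
open import Data.Product using (_×_; ∃-syntax; _,_)
open import Function.Bundles using (_⇔_; mk⇔)
open import Relation.Binary.PropositionalEquality
  using (_≡_; sym; trans; cong; cong₂; subst; module ≡-Reasoning)
open import Algebra.Lattice.Bundles using (DistributiveLattice)
import Algebra.Lattice.Properties.Lattice as LatticeProperties
import Relation.Binary.Lattice as OrderLattice
import Relation.Binary.Lattice.Properties.JoinSemilattice as JoinSemilatticeProperties
import Relation.Binary.Lattice.Properties.MeetSemilattice as MeetSemilatticeProperties
import Relation.Binary.Reasoning.PartialOrder as PartialOrderReasoning

module KleeneProperties {c : Level} (A : HAlgebra c) (K : IsKleene A) where

  open HAlgebra A hiding (_≤_)
  open IsKleene K

  distributiveLattice : DistributiveLattice c c
  distributiveLattice = record { isDistributiveLattice = isDistributiveLattice }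

  open DistributiveLattice distributiveLattice
    using (lattice; ∧-comm; ∧-assoc; ∨-comm; ∧-absorbs-∨; ∧-distribˡ-∨)
  -- The library order is x ≡ x ∧ y, the mirror image of x ∧ y ≡ x used for (hN2) in Defs.
  open OrderLattice.Lattice (LatticeProperties.∨-∧-orderTheoreticLattice lattice) public
    using (_≤_; poset; antisym; x≤x∨y; y≤x∨y; ∨-least; x∧y≤x; x∧y≤y; ∧-greatest;
           joinSemilattice; meetSemilattice)
    renaming (refl to ≤-refl; trans to ≤-trans)
  open JoinSemilatticeProperties joinSemilattice public using (∨-monotonic)
  open MeetSemilatticeProperties meetSemilattice public using (∧-monotonic)

  ∼-deMorgan-∨ : ∀ x y → ∼ (x ∨ y) ≡ ∼ x ∧ ∼ y
  ∼-deMorgan-∨ x y = begin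
    ∼ (x ∨ y)               ≡⟨ cong ∼_ (cong₂ _∨_ (∼-involutive x) (∼-involutive y)) ⟨
    ∼ (∼ (∼ x) ∨ ∼ (∼ y))   ≡⟨ cong ∼_ (∼-deMorgan (∼ x) (∼ y)) ⟨
    ∼ (∼ (∼ x ∧ ∼ y))       ≡⟨ ∼-involutive (∼ x ∧ ∼ y) ⟩
    ∼ x ∧ ∼ y               ∎
    where open ≡-Reasoning

  ∼-antitone : ∀ {x y} → x ≤ y → ∼ y ≤ ∼ x
  ∼-antitone {x} {y} x≡x∧y = begin
    ∼ y                 ≡⟨ ∧-absorbs-∨ (∼ y) (∼ x) ⟨
    ∼ y ∧ (∼ y ∨ ∼ x)   ≡⟨ cong (∼ y ∧_) (∨-comm (∼ y) (∼ x)) ⟩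
    ∼ y ∧ (∼ x ∨ ∼ y)   ≡⟨ cong (∼ y ∧_) (∼-deMorgan x y) ⟨
    ∼ y ∧ ∼ (x ∧ y)     ≡⟨ cong (λ u → ∼ y ∧ ∼ u) x≡x∧y ⟨
    ∼ y ∧ ∼ x           ∎
    where open ≡-Reasoning

  x≤𝟙 : ∀ x → x ≤ 𝟙
  x≤𝟙 x = sym (∧-identityʳ-𝟙 x)

  x∧∼x≤y∨∼y : ∀ x y → x ∧ ∼ x ≤ y ∨ ∼ y
  x∧∼x≤y∨∼y x y = sym (kleene x y)

  x∧∼x≤∼[x∧∼x] : ∀ x → x ∧ ∼ x ≤ ∼ (x ∧ ∼ x)
  x∧∼x≤∼[x∧∼x] x = begin
    x ∧ ∼ x          ≤⟨ x∧y≤y x (∼ x) ⟩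
    ∼ x              ≤⟨ x≤x∨y (∼ x) (∼ (∼ x)) ⟩
    ∼ x ∨ ∼ (∼ x)    ≡⟨ ∼-deMorgan x (∼ x) ⟨
    ∼ (x ∧ ∼ x)      ∎
    where open PartialOrderReasoning poset

  ≤∨⇒≡∧∨∧ : ∀ {x y z} → x ≤ y ∨ z → x ≡ (x ∧ y) ∨ (x ∧ z)
  ≤∨⇒≡∧∨∧ {x} {y} {z} x≡x∧[y∨z] = trans x≡x∧[y∨z] (∧-distribˡ-∨ x y z)

  -- Kleene's law gives x ∧ ∼x ≤ e ∨ ∼e = ∼e, so ∼x = ∼x ∧ (x ∨ e) lies below ∼x ∧ ∼e = ∼𝟙.
  x∨e≡𝟙⇒x≡𝟙 : ∀ {x e} → e ≤ ∼ e → x ∨ e ≡ 𝟙 → x ≡ 𝟙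
  x∨e≡𝟙⇒x≡𝟙 {x} {e} e≤∼e x∨e≡𝟙 = antisym (x≤𝟙 x) 𝟙≤x
    where
    open PartialOrderReasoning poset
    ∼x∧x≤∼e : ∼ x ∧ x ≤ ∼ e
    ∼x∧x≤∼e = begin
      ∼ x ∧ x    ≡⟨ ∧-comm (∼ x) x ⟩
      x ∧ ∼ x    ≤⟨ x∧∼x≤y∨∼y x e ⟩
      e ∨ ∼ e    ≤⟨ ∨-least e≤∼e ≤-refl ⟩
      ∼ e        ∎
    ∼x≤∼𝟙 : ∼ x ≤ ∼ 𝟙
    ∼x≤∼𝟙 = begin
      ∼ x                        ≤⟨ ∧-greatest ≤-refl (x≤𝟙 (∼ x)) ⟩
      ∼ x ∧ 𝟙                    ≡⟨ cong (∼ x ∧_) x∨e≡𝟙 ⟨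
      ∼ x ∧ (x ∨ e)              ≡⟨ ∧-distribˡ-∨ (∼ x) x e ⟩
      (∼ x ∧ x) ∨ (∼ x ∧ e)      ≤⟨ ∨-least (∧-greatest (x∧y≤x (∼ x) x) ∼x∧x≤∼e)
                                            (∧-monotonic ≤-refl e≤∼e) ⟩
      ∼ x ∧ ∼ e                  ≡⟨ ∼-deMorgan-∨ x e ⟨
      ∼ (x ∨ e)                  ≡⟨ cong ∼_ x∨e≡𝟙 ⟩
      ∼ 𝟙                        ∎
    𝟙≤x : 𝟙 ≤ x
    𝟙≤x = begin
      𝟙            ≡⟨ ∼-involutive 𝟙 ⟨
      ∼ (∼ 𝟙)      ≤⟨ ∼-antitone ∼x≤∼𝟙 ⟩
      ∼ (∼ x)      ≡⟨ ∼-involutive x ⟩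
      x            ∎

  x≤∼x∨y⇒x≤y∨[x∨y]∧∼[x∨y] : ∀ {x y} → x ≤ ∼ x ∨ y → x ≤ y ∨ (x ∨ y) ∧ ∼ (x ∨ y)
  x≤∼x∨y⇒x≤y∨[x∨y]∧∼[x∨y] {x} {y} x≤∼x∨y = begin
    x                        ≡⟨ ≤∨⇒≡∧∨∧ x≤∼x∨y ⟩
    (x ∧ ∼ x) ∨ (x ∧ y)      ≤⟨ ∨-least x∧∼x≤y∨e (≤-trans (x∧y≤y x y) (x≤x∨y y e)) ⟩
    y ∨ e                    ∎
    where
    open PartialOrderReasoning poset
    e = (x ∨ y) ∧ ∼ (x ∨ y)
    x∧∼x∧∼y≤e : (x ∧ ∼ x) ∧ ∼ y ≤ e
    x∧∼x∧∼y≤e = begin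
      (x ∧ ∼ x) ∧ ∼ y          ≤⟨ ∧-monotonic (∧-monotonic (x≤x∨y x y) ≤-refl) ≤-refl ⟩
      ((x ∨ y) ∧ ∼ x) ∧ ∼ y    ≡⟨ ∧-assoc (x ∨ y) (∼ x) (∼ y) ⟩
      (x ∨ y) ∧ (∼ x ∧ ∼ y)    ≡⟨ cong ((x ∨ y) ∧_) (∼-deMorgan-∨ x y) ⟨
      e                        ∎
    x∧∼x≤y∨e : x ∧ ∼ x ≤ y ∨ e
    x∧∼x≤y∨e = begin
      x ∧ ∼ x                              ≡⟨ ≤∨⇒≡∧∨∧ (x∧∼x≤y∨∼y x y) ⟩
      ((x ∧ ∼ x) ∧ y) ∨ ((x ∧ ∼ x) ∧ ∼ y)  ≤⟨ ∨-monotonic (x∧y≤y (x ∧ ∼ x) y) x∧∼x∧∼y≤e ⟩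
      y ∨ e                                ∎

module HNProperties {c : Level} (A : HAlgebra c) (K : IsKleene A) (H : SatisfiesHN A) where

  open HAlgebra A hiding (_≤_)
  open KleeneProperties A K
  open SatisfiesHN H

  x⇒y≡𝟙⇒x≤∼x∨y : ∀ {x y} → x ⇒ y ≡ 𝟙 → x ≤ ∼ x ∨ y
  x⇒y≡𝟙⇒x≤∼x∨y {x} {y} x⇒y≡𝟙 = begin
    x                ≤⟨ ∧-greatest ≤-refl (x≤𝟙 x) ⟩
    x ∧ 𝟙            ≡⟨ cong (x ∧_) x⇒y≡𝟙 ⟨
    x ∧ (x ⇒ y)      ≤⟨ sym (hN2 x y) ⟩
    x ∧ (∼ x ∨ y)    ≤⟨ x∧y≤y x (∼ x ∨ y) ⟩
    ∼ x ∨ y          ∎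
    where open PartialOrderReasoning poset

proposition14 : ∀ {c : Level} (A : HAlgebra c) → IsKleene A → SatisfiesHN A →
    (let open HAlgebra A in
      ∀ x y z → ((x ⇒ y) ∨ (z ∧ ∼ z)) ≡ ((x ∨ (z ∧ ∼ z)) ⇒ (y ∨ (z ∧ ∼ z)))) →
    let open HAlgebra A in
      ∀ x y → (((x ⇒ y) ≡ 𝟙) × ((y ⇒ x) ≡ 𝟙)) ⇔ (∃[ z ] ((x ∨ (z ∧ ∼ z)) ≡ (y ∨ (z ∧ ∼ z))))
proposition14 A K H ⇒-∨-z∧∼z x y = mk⇔ to from
  where
  open HAlgebra A hiding (_≤_)
  open KleeneProperties A K
  open DistributiveLattice distributiveLattice using (∨-comm)
  open HNProperties A K H
  open SatisfiesHN H using (hN1)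

  x∨e≡y∨e⇒x⇒y≡𝟙 : ∀ {x y} z → x ∨ (z ∧ ∼ z) ≡ y ∨ (z ∧ ∼ z) → x ⇒ y ≡ 𝟙
  x∨e≡y∨e⇒x⇒y≡𝟙 {x} {y} z x∨e≡y∨e = x∨e≡𝟙⇒x≡𝟙 (x∧∼x≤∼[x∧∼x] z) (begin
    (x ⇒ y) ∨ e          ≡⟨ ⇒-∨-z∧∼z x y z ⟩
    (x ∨ e) ⇒ (y ∨ e)    ≡⟨ cong (_⇒ (y ∨ e)) x∨e≡y∨e ⟩
    (y ∨ e) ⇒ (y ∨ e)    ≡⟨ hN1 (y ∨ e) ⟩
    𝟙                    ∎)
    where
    open ≡-Reasoning
    e = z ∧ ∼ z

  from : ∃[ z ] (x ∨ (z ∧ ∼ z) ≡ y ∨ (z ∧ ∼ z)) → (x ⇒ y ≡ 𝟙) × (y ⇒ x ≡ 𝟙)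
  from (z , x∨e≡y∨e) = x∨e≡y∨e⇒x⇒y≡𝟙 z x∨e≡y∨e , x∨e≡y∨e⇒x⇒y≡𝟙 z (sym x∨e≡y∨e)

  to : (x ⇒ y ≡ 𝟙) × (y ⇒ x ≡ 𝟙) → ∃[ z ] (x ∨ (z ∧ ∼ z) ≡ y ∨ (z ∧ ∼ z))
  to (x⇒y≡𝟙 , y⇒x≡𝟙) =
    x ∨ y , antisym (∨-least x≤y∨e (y≤x∨y y e)) (∨-least y≤x∨e (y≤x∨y x e))
    where
    e = (x ∨ y) ∧ ∼ (x ∨ y)
    x≤y∨e : x ≤ y ∨ e
    x≤y∨e = x≤∼x∨y⇒x≤y∨[x∨y]∧∼[x∨y] (x⇒y≡𝟙⇒x≤∼x∨y x⇒y≡𝟙)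
    y≤x∨e : y ≤ x ∨ e
    y≤x∨e = subst (λ z → y ≤ x ∨ z ∧ ∼ z) (∨-comm y x)
                  (x≤∼x∨y⇒x≤y∨[x∨y]∧∼[x∨y] (x⇒y≡𝟙⇒x≤∼x∨y y⇒x≡𝟙))
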